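{- As formal power series in $q$ (equivalently for $|q|<1$), \[ \sum_{n\geq 0} (q^{n+1};q)_\infty\, q^{\frac{n(n+1)}{2}} = \sum_{n\geq 0} (-q^{n+1};q)_\infty \frac{(-q;q)_n}{(q;q)_n} (-1)^n q^{\frac{n(n+1)}{2}}, \] and \[ \sum_{n\geq 0} (-q^{n+1};q)_\infty\, (-1)^n q^{\frac{n(n+1)}{2}} = \sum_{n\geq 0} (q^{n+1};q)_\infty \frac{(-q;q)_n}{(q;q)_n}\, q^{\frac{n(n+1)}{2}}. \]
   Context: The $q$-Pochhammer symbol is $(a;q)_n=\prod_{i=0}^{n-1}(1-aq^i)$ for $n\in\mathbb{Z}_{\ge 0}\cup\{\infty\}$. -}

module Defs where

open import Data.Nat as ℕ using (ℕ; zero; suc; _∸_)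
open import Data.Nat.Divisibility using (_∣?_)
open import Data.Integer as ℤ using (ℤ; +_; -_; _+_; _*_; _^_)
open import Relation.Nullary.Decidable using (does)
open import Data.Bool using (if_then_else_)
open import Relation.Binary.PropositionalEquality using (_≡_)

-- Formal power series in q with integer coefficients: n ↦ coefficient of q^n.
Series : Set
Series = ℕ → ℤ

Σ< : ℕ → (ℕ → ℤ) → ℤ
Σ< zero    f = + 0
Σ< (suc n) f = Σ< n f + f n

one : Series
one zero    = + 1
one (suc _) = + 0

mono : ℤ → ℕ → Series
mono c k n = if does (n ℕ.≟ k) then c else + 0

_⊕_ : Series → Series → Series
(f ⊕ g) n = f n + g n

_⊛_ : Series → Series → Series
(f ⊛ g) n = Σ< (suc n) (λ i → f i * g (n ∸ i))

∏< : ℕ → (ℕ → Series) → Series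
∏< zero    F = one
∏< (suc n) F = ∏< n F ⊛ F n

-- (a q^m ; q)_n = ∏_{i<n} (1 - a q^(m+i)),  for an integer constant a
poch : ℤ → ℕ → ℕ → Series
poch a m n = ∏< n (λ i → one ⊕ mono (- a) (m ℕ.+ i))

-- (a q^m ; q)_∞ : the q-adic limit of (a q^m ; q)_n.  Its coefficient of q^N
-- is that of the partial product with N+1 factors, since every further factor
-- is 1 + O(q^(N+1)).
pochInf : ℤ → ℕ → Series
pochInf a m N = poch a m (suc N) N

geomInv : ℕ → Series
geomInv i N = if does (suc i ∣? N) then + 1 else + 0
-- NB: geomInv i is 1/(1 - q^(i+1)).

invQPoch : ℕ → Series
invQPoch n = ∏< n geomInv

tri : ℕ → ℕ
tri zero    = 0
tri (suc n) = tri n ℕ.+ suc n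

-- Infinite sum Σ_{n≥0} t n of a family of series where t n is divisible by
-- q^n (true for all families below, which carry a factor q^(n(n+1)/2)):
-- the q-adic limit of partial sums, whose q^N-coefficient stabilises after
-- the terms n ≤ N.
sumInf : (ℕ → Series) → Series
sumInf t N = Σ< (suc N) (λ n → t n N)

sgn : ℕ → ℤ
sgn n = (- (+ 1)) ^ n

lhs1 : ℕ → Series
lhs1 n = pochInf (+ 1) (suc n) ⊛ mono (+ 1) (tri n)

rhs1 : ℕ → Series
rhs1 n = pochInf (- (+ 1)) (suc n) ⊛ (poch (- (+ 1)) 1 n ⊛ (invQPoch n ⊛ mono (sgn n) (tri n)))

lhs2 : ℕ → Series
lhs2 n = pochInf (- (+ 1)) (suc n) ⊛ mono (sgn n) (tri n)

rhs2 : ℕ → Series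
rhs2 n = pochInf (+ 1) (suc n) ⊛ (poch (- (+ 1)) 1 n ⊛ (invQPoch n ⊛ mono (+ 1) (tri n)))

-- Euler's expansion
--   (c q^{n+1};q)_∞ = Σ_k (-c)^k q^{nk + k(k+1)/2} / (q;q)_k
-- holds because both sides satisfy F_n = (1 - c q^{n+1}) F_{n+1} and agree
-- modulo q^{n+1}.  Substituting it into
--   Σ_n (c q^{n+1};q)_∞ c^n q^{n(n+1)/2}
--   and  Σ_n (-c q^{n+1};q)_∞ (-q;q)_n/(q;q)_n (-c)^n q^{n(n+1)/2}
-- and collecting the terms with n + k = m writes both as Σ_m c^m q^{m(m+1)/2} S_m,
-- with S_m = Σ_{k≤m} (-1)^k/(q;q)_k on the left and
-- S_m = Σ_{n+k=m} (-1)^n (-q;q)_n/((q;q)_n (q;q)_k) on the right.  Splitting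
-- 1/(q;q)_{k+1} = 1/(q;q)_k + q^{k+1}/(q;q)_{k+1} reduces the equality of the two
-- S_m to  Σ_{n+k=m} (-1)^n q^k (-q;q)_n/((q;q)_n (q;q)_k) = (-1)^m/(q;q)_m,  which
-- follows by induction on m after multiplying by 1 - q^m = (1 - q^n) + q^n (1 - q^k).
-- The two identities are the cases c = 1 and c = -1.

module Submission where

open import Defs
open import Algebra.Bundles using (CommutativeRing)
open import Algebra.Solver.Ring.AlmostCommutativeRing
  using (fromCommutativeRing; _-Raw-AlmostCommutative⟶_; Induced-equivalence)
open import Data.Bool using (if_then_else_)
open import Data.Integer as ℤ using (ℤ; +_; -_; _+_; _-_; _*_; _^_)
import Data.Integer.Properties as ℤP
import Data.Integer.Tactic.RingSolver as ℤ-Solver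
open import Data.Maybe using (just; nothing)
open import Data.Nat as ℕ using (ℕ; zero; suc; _∸_; s≤s; z≤n)
open import Data.Nat.Divisibility using (_∣_; _∣?_; _∣0; ∣m+n∣m⇒∣n; ∣m∸n∣n⇒∣m; ∣⇒≤; ∣-refl)
import Data.Nat.Properties as ℕP
import Data.Nat.Tactic.RingSolver as ℕ-Solver
open import Data.Product using (_×_; _,_)
open import Data.Sum using (inj₁; inj₂)
open import Function using (_∘_; mk⇔)
open import Level using (0ℓ)
open import Relation.Binary.Definitions using (WeaklyDecidable)
open import Relation.Binary.PropositionalEquality
import Relation.Binary.Reasoning.Setoid
open import Relation.Binary.Structures using (IsEquivalence)
open import Relation.Nullary using (yes; no)
open import Relation.Nullary.Decidable using (dec-true; dec-false; does-⇔)
open import Algebra.Properties.CommutativeSemigroup ℤP.+-commutativeSemigroup using (interchange)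

Σ<-cong : ∀ n {f g : ℕ → ℤ} → (∀ i → i ℕ.< n → f i ≡ g i) → Σ< n f ≡ Σ< n g
Σ<-cong zero    eq = refl
Σ<-cong (suc n) eq = cong₂ _+_ (Σ<-cong n (λ i i<n → eq i (ℕP.m<n⇒m<1+n i<n))) (eq n ℕP.≤-refl)

Σ<-zero : ∀ n {f : ℕ → ℤ} → (∀ i → i ℕ.< n → f i ≡ + 0) → Σ< n f ≡ + 0
Σ<-zero zero    eq = refl
Σ<-zero (suc n) eq = cong₂ _+_ (Σ<-zero n (λ i i<n → eq i (ℕP.m<n⇒m<1+n i<n))) (eq n ℕP.≤-refl)

Σ<-distrib-+ : ∀ n (f g : ℕ → ℤ) → Σ< n (λ i → f i + g i) ≡ Σ< n f + Σ< n g
Σ<-distrib-+ zero    f g = refl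
Σ<-distrib-+ (suc n) f g =
  trans (cong (_+ (f n + g n)) (Σ<-distrib-+ n f g)) (interchange (Σ< n f) (Σ< n g) (f n) (g n))

*-distribˡ-Σ< : ∀ n a (f : ℕ → ℤ) → a * Σ< n f ≡ Σ< n (λ i → a * f i)
*-distribˡ-Σ< zero    a f = ℤP.*-zeroʳ a
*-distribˡ-Σ< (suc n) a f =
  trans (ℤP.*-distribˡ-+ a (Σ< n f) (f n)) (cong (_+ a * f n) (*-distribˡ-Σ< n a f))

*-distribʳ-Σ< : ∀ n a (f : ℕ → ℤ) → Σ< n f * a ≡ Σ< n (λ i → f i * a)
*-distribʳ-Σ< n a f = begin
  Σ< n f * a               ≡⟨ ℤP.*-comm (Σ< n f) a ⟩
  a * Σ< n f               ≡⟨ *-distribˡ-Σ< n a f ⟩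
  Σ< n (λ i → a * f i)     ≡⟨ Σ<-cong n (λ i _ → ℤP.*-comm a (f i)) ⟩
  Σ< n (λ i → f i * a)     ∎
  where open ≡-Reasoning

Σ<-sucˡ : ∀ n (f : ℕ → ℤ) → Σ< (suc n) f ≡ f 0 + Σ< n (λ i → f (suc i))
Σ<-sucˡ zero    f = ℤP.+-comm (+ 0) (f 0)
Σ<-sucˡ (suc n) f =
  trans (cong (_+ f (suc n)) (Σ<-sucˡ n f)) (ℤP.+-assoc (f 0) _ (f (suc n)))

Σ<-reverse : ∀ n (f : ℕ → ℤ) → Σ< n f ≡ Σ< n (λ i → f (n ∸ suc i))
Σ<-reverse zero    f = refl
Σ<-reverse (suc n) f = begin
  Σ< n f + f n                          ≡⟨ cong (_+ f n) (Σ<-reverse n f) ⟩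
  Σ< n (λ i → f (n ∸ suc i)) + f n      ≡⟨ ℤP.+-comm _ (f n) ⟩
  f n + Σ< n (λ i → f (n ∸ suc i))      ≡⟨ Σ<-sucˡ n (λ i → f (n ∸ i)) ⟨
  Σ< (suc n) (λ i → f (n ∸ i))          ∎
  where open ≡-Reasoning

Σ<-comm : ∀ n m (F : ℕ → ℕ → ℤ) →
          Σ< n (λ i → Σ< m (F i)) ≡ Σ< m (λ j → Σ< n (λ i → F i j))
Σ<-comm zero    m F = sym (Σ<-zero m (λ _ _ → refl))
Σ<-comm (suc n) m F = begin
  Σ< n (λ i → Σ< m (F i)) + Σ< m (F n)             ≡⟨ cong (_+ Σ< m (F n)) (Σ<-comm n m F) ⟩
  Σ< m (λ j → Σ< n (λ i → F i j)) + Σ< m (F n)     ≡⟨ Σ<-distrib-+ m _ (F n) ⟨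
  Σ< m (λ j → Σ< (suc n) (λ i → F i j))            ∎
  where open ≡-Reasoning

Σ<-extend : ∀ {n} m (f : ℕ → ℤ) → n ℕ.≤ m → (∀ i → n ℕ.≤ i → f i ≡ + 0) → Σ< m f ≡ Σ< n f
Σ<-extend {n} zero f n≤0 vanish rewrite ℕP.n≤0⇒n≡0 n≤0 = refl
Σ<-extend {n} (suc m) f n≤1+m vanish with ℕP.m≤n⇒m<n∨m≡n n≤1+m
... | inj₂ refl      = refl
... | inj₁ (s≤s n≤m) =
  trans (cong₂ _+_ (Σ<-extend m f n≤m vanish) (vanish m n≤m)) (ℤP.+-identityʳ (Σ< n f))

Σ<-single : ∀ n d (f : ℕ → ℤ) → d ℕ.< n → (∀ i → i ≢ d → f i ≡ + 0) → Σ< n f ≡ f d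
Σ<-single (suc n) d f d<1+n vanish with d ℕ.≟ n
... | yes refl =
  trans (cong (_+ f d) (Σ<-zero d (λ i i<d → vanish i (ℕP.<⇒≢ i<d)))) (ℤP.+-identityˡ (f d))
... | no d≢n   =
  trans (cong₂ _+_ (Σ<-single n d f (ℕP.≤∧≢⇒< (ℕP.≤-pred d<1+n) d≢n) vanish) (vanish n (d≢n ∘ sym)))
        (ℤP.+-identityʳ (f d))

Σ<-triangle : ∀ n (F : ℕ → ℕ → ℤ) →
              Σ< (suc n) (λ k → Σ< (suc k) (λ i → F i k))
              ≡ Σ< (suc n) (λ i → Σ< (suc (n ∸ i)) (λ j → F i (i ℕ.+ j)))
Σ<-triangle zero    F = refl
Σ<-triangle (suc n) F = begin
  Σ< (suc (suc n)) (λ k → Σ< (suc k) (λ i → F i k))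
    ≡⟨ Σ<-cong (suc (suc n)) (λ k _ → Σ<-sucˡ k (λ i → F i k)) ⟩
  Σ< (suc (suc n)) (λ k → F 0 k + Σ< k (λ i → F (suc i) k))
    ≡⟨ Σ<-distrib-+ (suc (suc n)) (F 0) _ ⟩
  Σ< (suc (suc n)) (F 0) + Σ< (suc (suc n)) (λ k → Σ< k (λ i → F (suc i) k))
    ≡⟨ cong (λ x → Σ< (suc (suc n)) (F 0) + x) shifted ⟩
  Σ< (suc (suc n)) (F 0) + Σ< (suc n) (λ i → Σ< (suc (n ∸ i)) (λ j → F (suc i) (suc (i ℕ.+ j))))
    ≡⟨ Σ<-sucˡ (suc n) (λ i → Σ< (suc (suc n ∸ i)) (λ j → F i (i ℕ.+ j))) ⟨
  Σ< (suc (suc n)) (λ i → Σ< (suc (suc n ∸ i)) (λ j → F i (i ℕ.+ j))) ∎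
  where
  open ≡-Reasoning
  shifted : Σ< (suc (suc n)) (λ k → Σ< k (λ i → F (suc i) k))
            ≡ Σ< (suc n) (λ i → Σ< (suc (n ∸ i)) (λ j → F (suc i) (suc (i ℕ.+ j))))
  shifted = trans (Σ<-sucˡ (suc n) _)
                  (trans (ℤP.+-identityˡ _) (Σ<-triangle n (λ i k → F (suc i) (suc k))))

-- The ring of formal power series

infix 4 _≈_
record _≈_ (f g : Series) : Set where
  constructor coeffwise
  field coeff : ∀ N → f N ≡ g N
open _≈_ public

zeroS : Series
zeroS _ = + 0

negS : Series → Series
negS f N = - f N

⊛-cong : ∀ {f g h k} → f ≈ g → h ≈ k → f ⊛ h ≈ g ⊛ k
⊛-cong p q = coeffwise λ N → Σ<-cong (suc N) (λ i _ → cong₂ _*_ (coeff p i) (coeff q (N ∸ i)))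

⊛-comm : ∀ f g → f ⊛ g ≈ g ⊛ f
⊛-comm f g = coeffwise λ N →
  trans (Σ<-reverse (suc N) _) (Σ<-cong (suc N) (λ i i≤N → swap N i (ℕP.≤-pred i≤N)))
  where
  swap : ∀ N i → i ℕ.≤ N → f (N ∸ i) * g (N ∸ (N ∸ i)) ≡ g i * f (N ∸ i)
  swap N i i≤N rewrite ℕP.m∸[m∸n]≡n i≤N = ℤP.*-comm (f (N ∸ i)) (g i)

⊛-assoc : ∀ f g h → (f ⊛ g) ⊛ h ≈ f ⊛ (g ⊛ h)
⊛-assoc f g h = coeffwise λ N → begin
  Σ< (suc N) (λ k → Σ< (suc k) (λ i → f i * g (k ∸ i)) * h (N ∸ k))
    ≡⟨ Σ<-cong (suc N) (λ k _ → *-distribʳ-Σ< (suc k) (h (N ∸ k)) _) ⟩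
  Σ< (suc N) (λ k → Σ< (suc k) (λ i → f i * g (k ∸ i) * h (N ∸ k)))
    ≡⟨ Σ<-triangle N (λ i k → f i * g (k ∸ i) * h (N ∸ k)) ⟩
  Σ< (suc N) (λ i → Σ< (suc (N ∸ i)) (λ j → f i * g (i ℕ.+ j ∸ i) * h (N ∸ (i ℕ.+ j))))
    ≡⟨ Σ<-cong (suc N) (λ i _ → trans (Σ<-cong (suc (N ∸ i)) (λ j _ → reassoc N i j))
                                       (sym (*-distribˡ-Σ< (suc (N ∸ i)) (f i) _))) ⟩
  Σ< (suc N) (λ i → f i * Σ< (suc (N ∸ i)) (λ j → g j * h (N ∸ i ∸ j))) ∎
  where
  open ≡-Reasoning
  reassoc : ∀ N i j → f i * g (i ℕ.+ j ∸ i) * h (N ∸ (i ℕ.+ j)) ≡ f i * (g j * h (N ∸ i ∸ j))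
  reassoc N i j rewrite ℕP.m+n∸m≡n i j | ℕP.∸-+-assoc N i j = ℤP.*-assoc (f i) (g j) _

⊛-distribˡ-⊕ : ∀ f g h → f ⊛ (g ⊕ h) ≈ (f ⊛ g) ⊕ (f ⊛ h)
⊛-distribˡ-⊕ f g h = coeffwise λ N →
  trans (Σ<-cong (suc N) (λ i _ → ℤP.*-distribˡ-+ (f i) (g (N ∸ i)) (h (N ∸ i))))
        (Σ<-distrib-+ (suc N) _ _)

⊛-identityˡ : ∀ f → one ⊛ f ≈ f
⊛-identityˡ f = coeffwise λ N → begin
  Σ< (suc N) (λ i → one i * f (N ∸ i))
    ≡⟨ Σ<-sucˡ N _ ⟩
  + 1 * f N + Σ< N (λ i → + 0 * f (N ∸ suc i))
    ≡⟨ cong₂ _+_ (ℤP.*-identityˡ (f N)) (Σ<-zero N (λ i _ → ℤP.*-zeroˡ (f (N ∸ suc i)))) ⟩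
  f N + + 0
    ≡⟨ ℤP.+-identityʳ (f N) ⟩
  f N ∎
  where open ≡-Reasoning

≈-isEquivalence : IsEquivalence _≈_
≈-isEquivalence = record
  { refl  = coeffwise λ _ → refl
  ; sym   = λ p → coeffwise λ N → sym (coeff p N)
  ; trans = λ p q → coeffwise λ N → trans (coeff p N) (coeff q N)
  }

⊕-cong : ∀ {f g h k} → f ≈ g → h ≈ k → f ⊕ h ≈ g ⊕ k
⊕-cong p q = coeffwise λ N → cong₂ _+_ (coeff p N) (coeff q N)

Series-commutativeRing : CommutativeRing 0ℓ 0ℓ
Series-commutativeRing = record
  { Carrier = Series ; _≈_ = _≈_ ; _+_ = _⊕_ ; _*_ = _⊛_ ; -_ = negS ; 0# = zeroS ; 1# = one
  ; isCommutativeRing = record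
    { isRing = record
      { +-isAbelianGroup = record
        { isGroup = record
          { isMonoid = record
            { isSemigroup = record
              { isMagma = record { isEquivalence = ≈-isEquivalence ; ∙-cong = ⊕-cong }
              ; assoc = λ f g h → coeffwise λ N → ℤP.+-assoc (f N) (g N) (h N) }
            ; identity = (λ f → coeffwise λ N → ℤP.+-identityˡ (f N))
                       , (λ f → coeffwise λ N → ℤP.+-identityʳ (f N)) }
          ; inverse = (λ f → coeffwise λ N → ℤP.+-inverseˡ (f N))
                    , (λ f → coeffwise λ N → ℤP.+-inverseʳ (f N))
          ; ⁻¹-cong = λ p → coeffwise λ N → cong -_ (coeff p N) }
        ; comm = λ f g → coeffwise λ N → ℤP.+-comm (f N) (g N) }
      ; *-cong = ⊛-cong
      ; *-assoc = ⊛-assoc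
      ; *-identity = ⊛-identityˡ , λ f → ≈-trans (⊛-comm f one) (⊛-identityˡ f)
      ; distrib = ⊛-distribˡ-⊕ , λ f g h →
          ≈-trans (⊛-comm (g ⊕ h) f) (≈-trans (⊛-distribˡ-⊕ f g h) (⊕-cong (⊛-comm f g) (⊛-comm f h))) }
    ; *-comm = ⊛-comm } }
  where open IsEquivalence ≈-isEquivalence renaming (trans to ≈-trans)

module S = CommutativeRing Series-commutativeRing

module ≈-Reasoning = Relation.Binary.Reasoning.Setoid S.setoid

⊛-congˡ : ∀ f {g h} → g ≈ h → f ⊛ g ≈ f ⊛ h
⊛-congˡ f = ⊛-cong (S.refl {f})

⊛-congʳ : ∀ h {f g} → f ≈ g → f ⊛ h ≈ g ⊛ h
⊛-congʳ h f≈g = ⊛-cong f≈g (S.refl {h})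

⊕-congˡ : ∀ f {g h} → g ≈ h → f ⊕ g ≈ f ⊕ h
⊕-congˡ f = ⊕-cong (S.refl {f})

⊕-congʳ : ∀ h {f g} → f ≈ g → f ⊕ h ≈ g ⊕ h
⊕-congʳ h f≈g = ⊕-cong f≈g (S.refl {h})

mono-≡ : ∀ c d → mono c d d ≡ c
mono-≡ c d = cong (λ b → if b then c else + 0) (dec-true (d ℕ.≟ d) refl)

mono-≢ : ∀ c {d N} → N ≢ d → mono c d N ≡ + 0
mono-≢ c {d} {N} N≢d = cong (λ b → if b then c else + 0) (dec-false (N ℕ.≟ d) N≢d)

mono-map : ∀ (F : ℤ → ℤ) → F (+ 0) ≡ + 0 → ∀ c d N → F (mono c d N) ≡ mono (F c) d N
mono-map F F0 c d N with N ℕ.≟ d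
... | yes refl = trans (cong F (mono-≡ c N)) (sym (mono-≡ (F c) N))
... | no N≢d   = trans (cong F (mono-≢ c N≢d)) (trans F0 (sym (mono-≢ (F c) N≢d)))

mono-shift : ∀ c {d N} e → d ℕ.≤ N → mono c e (N ∸ d) ≡ mono c (d ℕ.+ e) N
mono-shift c {d} {N} e d≤N = cong (λ b → if b then c else + 0) (does-⇔ (mk⇔ to from) (N ∸ d ℕ.≟ e) (N ℕ.≟ d ℕ.+ e))
  where
  to : N ∸ d ≡ e → N ≡ d ℕ.+ e
  to eq = trans (sym (ℕP.m+[n∸m]≡n d≤N)) (cong (d ℕ.+_) eq)
  from : N ≡ d ℕ.+ e → N ∸ d ≡ e
  from eq = trans (cong (_∸ d) eq) (ℕP.m+n∸m≡n d e)

mono-⊛-coeff-≥ : ∀ c d g {N} → d ℕ.≤ N → (mono c d ⊛ g) N ≡ c * g (N ∸ d)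
mono-⊛-coeff-≥ c d g {N} d≤N =
  trans (Σ<-single (suc N) d _ (s≤s d≤N)
          (λ i i≢d → trans (cong (_* g (N ∸ i)) (mono-≢ c i≢d)) (ℤP.*-zeroˡ (g (N ∸ i)))))
        (cong (_* g (N ∸ d)) (mono-≡ c d))

mono-⊛-coeff-< : ∀ c d g {N} → N ℕ.< d → (mono c d ⊛ g) N ≡ + 0
mono-⊛-coeff-< c d g {N} N<d = Σ<-zero (suc N) λ i i≤N →
  trans (cong (_* g (N ∸ i)) (mono-≢ c (ℕP.<⇒≢ (ℕP.<-≤-trans i≤N N<d)))) (ℤP.*-zeroˡ (g (N ∸ i)))

mono-⊛-mono : ∀ a b d e → mono a d ⊛ mono b e ≈ mono (a * b) (d ℕ.+ e)
mono-⊛-mono a b d e = coeffwise coeff-N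
  where
  coeff-N : ∀ N → (mono a d ⊛ mono b e) N ≡ mono (a * b) (d ℕ.+ e) N
  coeff-N N with d ℕ.≤? N
  ... | yes d≤N = begin
    (mono a d ⊛ mono b e) N      ≡⟨ mono-⊛-coeff-≥ a d (mono b e) d≤N ⟩
    a * mono b e (N ∸ d)         ≡⟨ mono-map (a *_) (ℤP.*-zeroʳ a) b e (N ∸ d) ⟩
    mono (a * b) e (N ∸ d)       ≡⟨ mono-shift (a * b) e d≤N ⟩
    mono (a * b) (d ℕ.+ e) N     ∎
    where open ≡-Reasoning
  ... | no d≰N = trans (mono-⊛-coeff-< a d (mono b e) (ℕP.≰⇒> d≰N))
                       (sym (mono-≢ (a * b) (ℕP.<⇒≢ (ℕP.<-≤-trans (ℕP.≰⇒> d≰N) (ℕP.m≤m+n d e)))))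

mono-⊕-mono : ∀ a b d → mono a d ⊕ mono b d ≈ mono (a + b) d
mono-⊕-mono a b d = coeffwise coeff-N
  where
  coeff-N : ∀ N → mono a d N + mono b d N ≡ mono (a + b) d N
  coeff-N N with N ℕ.≟ d
  ... | yes refl = trans (cong₂ _+_ (mono-≡ a N) (mono-≡ b N)) (sym (mono-≡ (a + b) N))
  ... | no N≢d   = trans (cong₂ _+_ (mono-≢ a N≢d) (mono-≢ b N≢d)) (sym (mono-≢ (a + b) N≢d))

mono-neg : ∀ c d → mono (- c) d ≈ negS (mono c d)
mono-neg c d = coeffwise λ N → sym (mono-map -_ refl c d N)

mono-1-0≈one : mono (+ 1) 0 ≈ one
mono-1-0≈one = coeffwise λ { zero → refl ; (suc _) → refl }

mono-1-⊛ : ∀ d c e → mono (+ 1) d ⊛ mono c e ≈ mono c (d ℕ.+ e)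
mono-1-⊛ d c e = S.trans (mono-⊛-mono (+ 1) c d e) (S.reflexive (cong (λ a → mono a (d ℕ.+ e)) (ℤP.*-identityˡ c)))

-- Integer coefficients are read as constant series, so the ring solver compares
-- normal forms by computation in ℤ.
constant : ℤ.+-*-rawRing -Raw-AlmostCommutative⟶ fromCommutativeRing Series-commutativeRing
constant = record
  { ⟦_⟧    = λ c → mono c 0
  ; +-homo = λ a b → S.sym (mono-⊕-mono a b 0)
  ; *-homo = λ a b → S.sym (mono-⊛-mono a b 0 0)
  ; -‿homo = λ c → mono-neg c 0
  ; 0-homo = coeffwise λ { zero → refl ; (suc _) → refl }
  ; 1-homo = mono-1-0≈one
  }

constant-≟ : WeaklyDecidable (Induced-equivalence constant)
constant-≟ a b with a ℤ.≟ b
... | yes refl = just S.refl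
... | no _     = nothing

open import Algebra.Solver.Ring ℤ.+-*-rawRing (fromCommutativeRing Series-commutativeRing) constant constant-≟
  using (solve; _:=_; _:+_; _:-_; _:*_; :-_; con)

-- q-adically convergent sums

infix 4 q^_∣_
q^_∣_ : ℕ → Series → Set
q^ d ∣ f = ∀ {N} → N ℕ.< d → f N ≡ + 0

q^∣-weaken : ∀ {d e} f → e ℕ.≤ d → q^ d ∣ f → q^ e ∣ f
q^∣-weaken f e≤d q^d∣f N<e = q^d∣f (ℕP.<-≤-trans N<e e≤d)

⊛-coeff-local : ∀ f {g h} N → (∀ {j} → j ℕ.≤ N → g j ≡ h j) → (f ⊛ g) N ≡ (f ⊛ h) N
⊛-coeff-local f N g≡h = Σ<-cong (suc N) (λ i _ → cong (f i *_) (g≡h (ℕP.m∸n≤m N i)))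

Summable : (ℕ → Series) → Set
Summable t = ∀ n → q^ n ∣ t n

sumInf-coeff : ∀ {t} → Summable t → ∀ {N K} → N ℕ.< K → sumInf t N ≡ Σ< K (λ n → t n N)
sumInf-coeff t-summable N<K = sym (Σ<-extend _ _ N<K (λ n N<n → t-summable n N<n))

sumInf-cong : ∀ {t s} → (∀ n → t n ≈ s n) → sumInf t ≈ sumInf s
sumInf-cong t≈s = coeffwise λ N → Σ<-cong (suc N) (λ n _ → coeff (t≈s n) N)

sumInf-⊕ : ∀ t s → sumInf (λ n → t n ⊕ s n) ≈ sumInf t ⊕ sumInf s
sumInf-⊕ t s = coeffwise λ N → Σ<-distrib-+ (suc N) (λ n → t n N) (λ n → s n N)

sumInf-⊛ˡ : ∀ f {t} → Summable t → f ⊛ sumInf t ≈ sumInf (λ n → f ⊛ t n)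
sumInf-⊛ˡ f {t} t-summable = coeffwise λ N → begin
  Σ< (suc N) (λ i → f i * sumInf t (N ∸ i))
    ≡⟨ Σ<-cong (suc N) (λ i _ → cong (f i *_) (sumInf-coeff t-summable (s≤s (ℕP.m∸n≤m N i)))) ⟩
  Σ< (suc N) (λ i → f i * Σ< (suc N) (λ n → t n (N ∸ i)))
    ≡⟨ Σ<-cong (suc N) (λ i _ → *-distribˡ-Σ< (suc N) (f i) _) ⟩
  Σ< (suc N) (λ i → Σ< (suc N) (λ n → f i * t n (N ∸ i)))
    ≡⟨ Σ<-comm (suc N) (suc N) (λ i n → f i * t n (N ∸ i)) ⟩
  Σ< (suc N) (λ n → Σ< (suc N) (λ i → f i * t n (N ∸ i))) ∎
  where open ≡-Reasoning

sumInf-⊛ʳ : ∀ f {t} → Summable t → sumInf t ⊛ f ≈ sumInf (λ n → t n ⊛ f)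
sumInf-⊛ʳ f {t} t-summable = begin
  sumInf t ⊛ f                ≈⟨ S.*-comm (sumInf t) f ⟩
  f ⊛ sumInf t                ≈⟨ sumInf-⊛ˡ f t-summable ⟩
  sumInf (λ n → f ⊛ t n)      ≈⟨ sumInf-cong (λ n → S.*-comm f (t n)) ⟩
  sumInf (λ n → t n ⊛ f)      ∎
  where open ≈-Reasoning

sumInf-sucˡ : ∀ {t} → Summable t → sumInf t ≈ t 0 ⊕ sumInf (t ∘ suc)
sumInf-sucˡ {t} t-summable = coeffwise λ N → begin
  Σ< (suc N) (λ n → t n N)                         ≡⟨ Σ<-sucˡ N (λ n → t n N) ⟩
  t 0 N + Σ< N (λ n → t (suc n) N)                 ≡⟨ cong (_+_ (t 0 N)) (ℤP.+-identityʳ _) ⟨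
  t 0 N + (Σ< N (λ n → t (suc n) N) + + 0)         ≡⟨ cong (λ x → t 0 N + (Σ< N (λ n → t (suc n) N) + x))
                                                          (t-summable (suc N) ℕP.≤-refl) ⟨
  t 0 N + Σ< (suc N) (λ n → t (suc n) N)           ∎
  where open ≡-Reasoning

q^∣-sumInf : ∀ {d} t → (∀ n → q^ d ∣ t n) → q^ d ∣ sumInf t
q^∣-sumInf {d} t q^d∣t {N} N<d = Σ<-zero (suc N) (λ n _ → q^d∣t n N<d)

antidiag : ℕ → (ℕ → ℕ → Series) → Series
antidiag zero    G = G 0 0
antidiag (suc m) G = G 0 (suc m) ⊕ antidiag m (λ n k → G (suc n) k)

antidiag-coeff : ∀ m G N → antidiag m G N ≡ Σ< (suc m) (λ n → G n (m ∸ n) N)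
antidiag-coeff zero    G N = sym (ℤP.+-identityˡ (G 0 0 N))
antidiag-coeff (suc m) G N =
  trans (cong (_+_ (G 0 (suc m) N)) (antidiag-coeff m (λ n k → G (suc n) k) N))
        (sym (Σ<-sucˡ (suc m) (λ n → G n (suc m ∸ n) N)))

antidiag-cong : ∀ m {G H} → (∀ n k → n ℕ.+ k ≡ m → G n k ≈ H n k) → antidiag m G ≈ antidiag m H
antidiag-cong zero    G≈H = G≈H 0 0 refl
antidiag-cong (suc m) G≈H =
  S.+-cong (G≈H 0 (suc m) refl) (antidiag-cong m (λ n k eq → G≈H (suc n) k (cong suc eq)))

antidiag-⊕ : ∀ m G H → antidiag m (λ n k → G n k ⊕ H n k) ≈ antidiag m G ⊕ antidiag m H
antidiag-⊕ m G H = coeffwise λ N → begin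
  antidiag m (λ n k → G n k ⊕ H n k) N
    ≡⟨ antidiag-coeff m _ N ⟩
  Σ< (suc m) (λ n → G n (m ∸ n) N + H n (m ∸ n) N)
    ≡⟨ Σ<-distrib-+ (suc m) _ _ ⟩
  Σ< (suc m) (λ n → G n (m ∸ n) N) + Σ< (suc m) (λ n → H n (m ∸ n) N)
    ≡⟨ cong₂ _+_ (antidiag-coeff m G N) (antidiag-coeff m H N) ⟨
  antidiag m G N + antidiag m H N ∎
  where open ≡-Reasoning

antidiag-neg : ∀ m G → antidiag m (λ n k → negS (G n k)) ≈ negS (antidiag m G)
antidiag-neg zero    G = S.refl
antidiag-neg (suc m) G = S.trans (⊕-congˡ (negS (G 0 (suc m))) (antidiag-neg m (λ n k → G (suc n) k)))
                                 (coeffwise λ N → sym (ℤP.neg-distrib-+ (G 0 (suc m) N) _))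

antidiag-⊛ : ∀ m f G → f ⊛ antidiag m G ≈ antidiag m (λ n k → f ⊛ G n k)
antidiag-⊛ zero    f G = S.refl
antidiag-⊛ (suc m) f G = S.trans (S.distribˡ f (G 0 (suc m)) (antidiag m (λ n k → G (suc n) k)))
                                 (⊕-congˡ (f ⊛ G 0 (suc m)) (antidiag-⊛ m f (λ n k → G (suc n) k)))

antidiag-sucʳ : ∀ m G → antidiag (suc m) G ≈ antidiag m (λ n k → G n (suc k)) ⊕ G (suc m) 0
antidiag-sucʳ zero    G = S.refl
antidiag-sucʳ (suc m) G = S.trans (⊕-congˡ (G 0 (suc (suc m))) (antidiag-sucʳ m (λ n k → G (suc n) k)))
                                  (S.sym (S.+-assoc (G 0 (suc (suc m))) _ (G (suc (suc m)) 0)))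

Summable₂ : (ℕ → ℕ → Series) → Set
Summable₂ u = ∀ n k → q^ (n ℕ.+ k) ∣ u n k

sumInf-antidiag : ∀ {u} → Summable₂ u → sumInf (λ n → sumInf (u n)) ≈ sumInf (λ m → antidiag m u)
sumInf-antidiag {u} u-summable = coeffwise λ N → sym (begin
  Σ< (suc N) (λ m → antidiag m u N)
    ≡⟨ Σ<-cong (suc N) (λ m _ → antidiag-coeff m u N) ⟩
  Σ< (suc N) (λ m → Σ< (suc m) (λ n → u n (m ∸ n) N))
    ≡⟨ Σ<-triangle N (λ n m → u n (m ∸ n) N) ⟩
  Σ< (suc N) (λ n → Σ< (suc (N ∸ n)) (λ k → u n (n ℕ.+ k ∸ n) N))
    ≡⟨ Σ<-cong (suc N) (λ n n≤N → trans (Σ<-cong (suc (N ∸ n)) (λ k _ → cong (λ j → u n j N) (ℕP.m+n∸m≡n n k)))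
                                         (sym (row N n (ℕP.≤-pred n≤N)))) ⟩
  Σ< (suc N) (λ n → Σ< (suc N) (λ k → u n k N)) ∎)
  where
  open ≡-Reasoning
  row : ∀ N n → n ℕ.≤ N → Σ< (suc N) (λ k → u n k N) ≡ Σ< (suc (N ∸ n)) (λ k → u n k N)
  row N n n≤N = Σ<-extend (suc N) _ (s≤s (ℕP.m∸n≤m N n)) λ k N∸n<k →
    u-summable n k (subst (ℕ._< n ℕ.+ k) (ℕP.m+[n∸m]≡n n≤N) (ℕP.+-monoʳ-< n N∸n<k))

factor : ℤ → ℕ → Series
factor a d = one ⊕ mono (- a) d

factor≈1+mono : ∀ a d → factor a d ≈ mono (+ 1) 0 ⊕ mono (- a) d
factor≈1+mono a d = ⊕-congʳ (mono (- a) d) (S.sym mono-1-0≈one)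

factor≈1-mono : ∀ a d → factor a d ≈ mono (+ 1) 0 ⊕ negS (mono a d)
factor≈1-mono a d = S.trans (factor≈1+mono a d) (⊕-congˡ (mono (+ 1) 0) (mono-neg a d))

⊛-factor-coeff : ∀ f a d N → (f ⊛ factor a d) N ≡ f N + (mono (- a) d ⊛ f) N
⊛-factor-coeff f a d N = coeff (S.trans (S.distribˡ f one (mono (- a) d))
                                        (S.+-cong (S.*-identityʳ f) (S.*-comm f (mono (- a) d)))) N

geomInv-coeff-periodic : ∀ n {N} → suc n ℕ.≤ N → geomInv n N ≡ geomInv n (N ∸ suc n)
geomInv-coeff-periodic n {N} n<N = cong (λ b → if b then + 1 else + 0)
  (does-⇔ (mk⇔ to (λ d∣N∸d → ∣m∸n∣n⇒∣m (suc n) n<N d∣N∸d ∣-refl)) (suc n ∣? N) (suc n ∣? (N ∸ suc n)))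
  where
  to : suc n ∣ N → suc n ∣ N ∸ suc n
  to d∣N = ∣m+n∣m⇒∣n (subst (suc n ∣_) (sym (ℕP.m+[n∸m]≡n n<N)) d∣N) ∣-refl

geomInv-coeff-below : ∀ n {N} → N ℕ.< suc n → geomInv n N ≡ one N
geomInv-coeff-below n {zero}  _   = cong (λ b → if b then + 1 else + 0) (dec-true (suc n ∣? 0) (suc n ∣0))
geomInv-coeff-below n {suc N} N<n = cong (λ b → if b then + 1 else + 0)
  (dec-false (suc n ∣? suc N) (λ d∣N → ℕP.<⇒≱ N<n (∣⇒≤ d∣N)))

geomInv-⊛-factor : ∀ n → geomInv n ⊛ factor (+ 1) (suc n) ≈ one
geomInv-⊛-factor n = coeffwise λ N →
  trans (⊛-factor-coeff (geomInv n) (+ 1) (suc n) N) (coeff-N N)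
  where
  coeff-N : ∀ N → geomInv n N + (mono (- + 1) (suc n) ⊛ geomInv n) N ≡ one N
  coeff-N N with suc n ℕ.≤? N
  ... | yes n<N = begin
    geomInv n N + (mono (- + 1) (suc n) ⊛ geomInv n) N
      ≡⟨ cong₂ _+_ (geomInv-coeff-periodic n n<N) (mono-⊛-coeff-≥ (- + 1) (suc n) (geomInv n) n<N) ⟩
    geomInv n (N ∸ suc n) + - + 1 * geomInv n (N ∸ suc n)
      ≡⟨ cong (_+_ (geomInv n (N ∸ suc n))) (ℤP.-1*i≡-i (geomInv n (N ∸ suc n))) ⟩
    geomInv n (N ∸ suc n) - geomInv n (N ∸ suc n)
      ≡⟨ ℤP.+-inverseʳ (geomInv n (N ∸ suc n)) ⟩
    + 0
      ≡⟨ one-coeff-pos n<N ⟨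
    one N ∎
    where
    open ≡-Reasoning
    one-coeff-pos : ∀ {N} → suc n ℕ.≤ N → one N ≡ + 0
    one-coeff-pos {suc N} _ = refl
  ... | no n≮N = begin
    geomInv n N + (mono (- + 1) (suc n) ⊛ geomInv n) N
      ≡⟨ cong (_+_ (geomInv n N)) (mono-⊛-coeff-< (- + 1) (suc n) (geomInv n) (ℕP.≰⇒> n≮N)) ⟩
    geomInv n N + + 0
      ≡⟨ ℤP.+-identityʳ (geomInv n N) ⟩
    geomInv n N
      ≡⟨ geomInv-coeff-below n (ℕP.≰⇒> n≮N) ⟩
    one N ∎
    where open ≡-Reasoning

invQPoch-⊛-factor : ∀ k → invQPoch (suc k) ⊛ factor (+ 1) (suc k) ≈ invQPoch k
invQPoch-⊛-factor k = begin
  (invQPoch k ⊛ geomInv k) ⊛ factor (+ 1) (suc k)   ≈⟨ S.*-assoc (invQPoch k) (geomInv k) (factor (+ 1) (suc k)) ⟩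
  invQPoch k ⊛ (geomInv k ⊛ factor (+ 1) (suc k))   ≈⟨ ⊛-congˡ (invQPoch k) (geomInv-⊛-factor k) ⟩
  invQPoch k ⊛ one                                  ≈⟨ S.*-identityʳ (invQPoch k) ⟩
  invQPoch k                                        ∎
  where open ≈-Reasoning

factor-cancelˡ : ∀ k {f g} → factor (+ 1) (suc k) ⊛ f ≈ factor (+ 1) (suc k) ⊛ g → f ≈ g
factor-cancelˡ k {f} {g} eq = begin
  f                                              ≈⟨ cancel f ⟨
  geomInv k ⊛ (factor (+ 1) (suc k) ⊛ f)         ≈⟨ ⊛-congˡ (geomInv k) eq ⟩
  geomInv k ⊛ (factor (+ 1) (suc k) ⊛ g)         ≈⟨ cancel g ⟩
  g                                              ∎
  where
  open ≈-Reasoning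
  cancel : ∀ h → geomInv k ⊛ (factor (+ 1) (suc k) ⊛ h) ≈ h
  cancel h = S.trans (S.sym (S.*-assoc (geomInv k) (factor (+ 1) (suc k)) h))
                     (S.trans (⊛-congʳ h (geomInv-⊛-factor k)) (S.*-identityˡ h))

invQPoch-suc : ∀ k → invQPoch (suc k) ≈ invQPoch k ⊕ (mono (+ 1) (suc k) ⊛ invQPoch (suc k))
invQPoch-suc k = begin
  I′
    ≈⟨ solve 2 (λ x y → x := x :* (con (+ 1) :- y) :+ y :* x) S.refl I′ q ⟩
  (I′ ⊛ (mono (+ 1) 0 ⊕ negS q)) ⊕ (q ⊛ I′)
    ≈⟨ ⊕-congʳ (q ⊛ I′) (S.trans (⊛-congˡ I′ (S.sym (factor≈1-mono (+ 1) (suc k)))) (invQPoch-⊛-factor k)) ⟩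
  invQPoch k ⊕ (q ⊛ I′) ∎
  where
  open ≈-Reasoning
  I′ = invQPoch (suc k)
  q = mono (+ 1) (suc k)

poch-sucˡ : ∀ a m K → poch a m (suc K) ≈ factor a m ⊛ poch a (suc m) K
poch-sucˡ a m zero = begin
  one ⊛ factor a (m ℕ.+ 0)   ≈⟨ S.*-identityˡ (factor a (m ℕ.+ 0)) ⟩
  factor a (m ℕ.+ 0)         ≡⟨ cong (factor a) (ℕP.+-identityʳ m) ⟩
  factor a m                 ≈⟨ S.*-identityʳ (factor a m) ⟨
  factor a m ⊛ one           ∎
  where open ≈-Reasoning
poch-sucˡ a m (suc K) = begin
  poch a m (suc K) ⊛ factor a (m ℕ.+ suc K)
    ≈⟨ ⊛-congʳ (factor a (m ℕ.+ suc K)) (poch-sucˡ a m K) ⟩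
  (factor a m ⊛ poch a (suc m) K) ⊛ factor a (m ℕ.+ suc K)
    ≈⟨ S.*-assoc (factor a m) (poch a (suc m) K) (factor a (m ℕ.+ suc K)) ⟩
  factor a m ⊛ (poch a (suc m) K ⊛ factor a (m ℕ.+ suc K))
    ≡⟨ cong (λ d → factor a m ⊛ (poch a (suc m) K ⊛ factor a d)) (ℕP.+-suc m K) ⟩
  factor a m ⊛ poch a (suc m) (suc K) ∎
  where open ≈-Reasoning

poch-suc-coeff : ∀ a m K {N} → N ℕ.< m ℕ.+ K → poch a m (suc K) N ≡ poch a m K N
poch-suc-coeff a m K {N} N<m+K = begin
  (poch a m K ⊛ factor a (m ℕ.+ K)) N                     ≡⟨ ⊛-factor-coeff (poch a m K) a (m ℕ.+ K) N ⟩
  poch a m K N + (mono (- a) (m ℕ.+ K) ⊛ poch a m K) N   ≡⟨ cong (_+_ (poch a m K N)) (mono-⊛-coeff-< (- a) (m ℕ.+ K) (poch a m K) N<m+K) ⟩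
  poch a m K N + + 0                                     ≡⟨ ℤP.+-identityʳ (poch a m K N) ⟩
  poch a m K N                                           ∎
  where open ≡-Reasoning

poch-coeff-stable : ∀ a m {N K} → N ℕ.< m ℕ.+ K → ∀ K′ → K ℕ.≤ K′ → poch a m K′ N ≡ poch a m K N
poch-coeff-stable a m {N} {K} N<m+K zero K≤0 rewrite ℕP.n≤0⇒n≡0 K≤0 = refl
poch-coeff-stable a m {N} {K} N<m+K (suc K′) K≤1+K′ with ℕP.m≤n⇒m<n∨m≡n K≤1+K′
... | inj₂ refl       = refl
... | inj₁ (s≤s K≤K′) = trans (poch-suc-coeff a m K′ (ℕP.<-≤-trans N<m+K (ℕP.+-monoʳ-≤ m K≤K′)))
                              (poch-coeff-stable a m N<m+K K′ K≤K′)

pochInf-coeff : ∀ a m {N} K → N ℕ.≤ K → poch a (suc m) K N ≡ pochInf a (suc m) N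
pochInf-coeff a m {N} K N≤K = trans (poch-coeff-stable a (suc m) N<1+m+N K N≤K)
                                    (sym (poch-coeff-stable a (suc m) N<1+m+N (suc N) (ℕP.n≤1+n N)))
  where
  N<1+m+N : N ℕ.< suc m ℕ.+ N
  N<1+m+N = s≤s (ℕP.m≤n+m N m)

pochInf-sucˡ : ∀ a m → pochInf a (suc m) ≈ factor a (suc m) ⊛ pochInf a (suc (suc m))
pochInf-sucˡ a m = coeffwise λ N → trans (coeff (poch-sucˡ a (suc m) N) N)
  (⊛-coeff-local (factor a (suc m)) N (λ {j} j≤N → pochInf-coeff a (suc m) N j≤N))

pochInf-coeff-low : ∀ a m {N} → N ℕ.≤ m → pochInf a (suc m) N ≡ one N
pochInf-coeff-low a m {N} N≤m = poch-coeff-stable a (suc m) (s≤s (ℕP.≤-trans N≤m (ℕP.m≤m+n m 0))) (suc N) z≤n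

-- Euler's expansion of (c q^{n+1};q)_∞

tri-≥ : ∀ k → k ℕ.≤ tri k
tri-≥ zero    = z≤n
tri-≥ (suc k) = ℕP.m≤n+m (suc k) (tri k)

eulerTerm : ℤ → ℕ → ℕ → Series
eulerTerm c n k = mono ((- c) ^ k) (n ℕ.* k ℕ.+ tri k) ⊛ invQPoch k

eulerTerm-summable : ∀ c n → Summable (eulerTerm c n)
eulerTerm-summable c n k = q^∣-weaken (eulerTerm c n k) (ℕP.≤-trans (tri-≥ k) (ℕP.m≤n+m (tri k) (n ℕ.* k)))
                             (mono-⊛-coeff-< ((- c) ^ k) (n ℕ.* k ℕ.+ tri k) (invQPoch k))

eulerTerm-zero : ∀ c n → eulerTerm c n 0 ≈ one
eulerTerm-zero c n = begin
  mono (+ 1) (n ℕ.* 0 ℕ.+ 0) ⊛ one   ≡⟨ cong (λ d → mono (+ 1) d ⊛ one) (trans (ℕP.+-identityʳ (n ℕ.* 0)) (ℕP.*-zeroʳ n)) ⟩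
  mono (+ 1) 0 ⊛ one                 ≈⟨ S.*-identityʳ (mono (+ 1) 0) ⟩
  mono (+ 1) 0                       ≈⟨ mono-1-0≈one ⟩
  one                                ∎
  where open ≈-Reasoning

eulerSum-coeff-low : ∀ c n {N} → N ℕ.≤ n → sumInf (eulerTerm c n) N ≡ one N
eulerSum-coeff-low c n {N} N≤n = begin
  sumInf (eulerTerm c n) N
    ≡⟨ coeff (sumInf-sucˡ (eulerTerm-summable c n)) N ⟩
  eulerTerm c n 0 N + sumInf (eulerTerm c n ∘ suc) N
    ≡⟨ cong₂ _+_ (coeff (eulerTerm-zero c n) N) (q^∣-sumInf (eulerTerm c n ∘ suc) q^1+n∣ (s≤s N≤n)) ⟩
  one N + + 0
    ≡⟨ ℤP.+-identityʳ (one N) ⟩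
  one N ∎
  where
  open ≡-Reasoning
  q^1+n∣ : ∀ k → q^ suc n ∣ eulerTerm c n (suc k)
  q^1+n∣ k = q^∣-weaken (eulerTerm c n (suc k))
    (subst (ℕ._≤ n ℕ.* suc k ℕ.+ tri (suc k)) (ℕP.+-comm n 1)
           (ℕP.+-mono-≤ (ℕP.m≤m*n n (suc k)) (ℕP.≤-trans (s≤s z≤n) (tri-≥ (suc k)))))
    (mono-⊛-coeff-< ((- c) ^ suc k) (n ℕ.* suc k ℕ.+ tri (suc k)) (invQPoch (suc k)))

eulerTerm-suc : ∀ c n k → eulerTerm c n (suc k) ≈ (mono (- c) (suc n) ⊛ eulerTerm c (suc n) k) ⊕ eulerTerm c (suc n) (suc k)
eulerTerm-suc c n k = begin
  mono a d ⊛ invQPoch (suc k)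
    ≈⟨ ⊛-congˡ (mono a d) (invQPoch-suc k) ⟩
  mono a d ⊛ (invQPoch k ⊕ (mono (+ 1) (suc k) ⊛ invQPoch (suc k)))
    ≈⟨ solve 4 (λ x y z w → x :* (y :+ z :* w) := x :* y :+ (x :* z) :* w) S.refl
         (mono a d) (invQPoch k) (mono (+ 1) (suc k)) (invQPoch (suc k)) ⟩
  (mono a d ⊛ invQPoch k) ⊕ ((mono a d ⊛ mono (+ 1) (suc k)) ⊛ invQPoch (suc k))
    ≈⟨ S.+-cong first second ⟩
  (mono (- c) (suc n) ⊛ eulerTerm c (suc n) k) ⊕ eulerTerm c (suc n) (suc k) ∎
  where
  open ≈-Reasoning
  a = (- c) ^ suc k
  d = n ℕ.* suc k ℕ.+ tri (suc k)
  first : mono a d ⊛ invQPoch k ≈ mono (- c) (suc n) ⊛ eulerTerm c (suc n) k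
  first = begin
    mono a d ⊛ invQPoch k
      ≡⟨ cong (λ e → mono a e ⊛ invQPoch k) (exponent n k (tri k)) ⟩
    mono (- c * (- c) ^ k) (suc n ℕ.+ (suc n ℕ.* k ℕ.+ tri k)) ⊛ invQPoch k
      ≈⟨ ⊛-congʳ (invQPoch k) (mono-⊛-mono (- c) ((- c) ^ k) (suc n) (suc n ℕ.* k ℕ.+ tri k)) ⟨
    (mono (- c) (suc n) ⊛ mono ((- c) ^ k) (suc n ℕ.* k ℕ.+ tri k)) ⊛ invQPoch k
      ≈⟨ S.*-assoc (mono (- c) (suc n)) (mono ((- c) ^ k) (suc n ℕ.* k ℕ.+ tri k)) (invQPoch k) ⟩
    mono (- c) (suc n) ⊛ eulerTerm c (suc n) k ∎
    where
    exponent : ∀ n k t → n ℕ.* suc k ℕ.+ (t ℕ.+ suc k) ≡ suc n ℕ.+ (suc n ℕ.* k ℕ.+ t)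
    exponent = ℕ-Solver.solve-∀
  second : (mono a d ⊛ mono (+ 1) (suc k)) ⊛ invQPoch (suc k) ≈ eulerTerm c (suc n) (suc k)
  second = ⊛-congʳ (invQPoch (suc k)) (S.trans (mono-⊛-mono a (+ 1) d (suc k))
             (S.reflexive (cong₂ mono (ℤP.*-identityʳ a) (exponent n k (tri k)))))
    where
    exponent : ∀ n k t → n ℕ.* suc k ℕ.+ (t ℕ.+ suc k) ℕ.+ suc k ≡ suc n ℕ.* suc k ℕ.+ (t ℕ.+ suc k)
    exponent = ℕ-Solver.solve-∀

eulerSum-sucˡ : ∀ c n → sumInf (eulerTerm c n) ≈ factor c (suc n) ⊛ sumInf (eulerTerm c (suc n))
eulerSum-sucˡ c n = begin
  sumInf (eulerTerm c n)
    ≈⟨ sumInf-sucˡ (eulerTerm-summable c n) ⟩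
  eulerTerm c n 0 ⊕ sumInf (eulerTerm c n ∘ suc)
    ≈⟨ S.+-cong (S.trans (eulerTerm-zero c n) (S.sym (eulerTerm-zero c (suc n)))) (sumInf-cong (eulerTerm-suc c n)) ⟩
  e 0 ⊕ sumInf (λ k → (M ⊛ e k) ⊕ e (suc k))
    ≈⟨ ⊕-congˡ (e 0) (S.trans (sumInf-⊕ (λ k → M ⊛ e k) (e ∘ suc))
                               (⊕-congʳ (sumInf (e ∘ suc)) (S.sym (sumInf-⊛ˡ M (eulerTerm-summable c (suc n)))))) ⟩
  e 0 ⊕ ((M ⊛ E) ⊕ sumInf (e ∘ suc))
    ≈⟨ solve 3 (λ x y z → x :+ (y :+ z) := (x :+ z) :+ y) S.refl (e 0) (M ⊛ E) (sumInf (e ∘ suc)) ⟩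
  (e 0 ⊕ sumInf (e ∘ suc)) ⊕ (M ⊛ E)
    ≈⟨ ⊕-congʳ (M ⊛ E) (sumInf-sucˡ (eulerTerm-summable c (suc n))) ⟨
  E ⊕ (M ⊛ E)
    ≈⟨ ⊕-congʳ (M ⊛ E) (S.*-identityˡ E) ⟨
  (one ⊛ E) ⊕ (M ⊛ E)
    ≈⟨ S.distribʳ E one M ⟨
  factor c (suc n) ⊛ E ∎
  where
  open ≈-Reasoning
  e = eulerTerm c (suc n)
  E = sumInf e
  M = mono (- c) (suc n)

≈-unique-recurrence : ∀ (F X Y : ℕ → Series) →
  (∀ n → X n ≈ F n ⊛ X (suc n)) → (∀ n → Y n ≈ F n ⊛ Y (suc n)) →
  (∀ n {N} → N ℕ.≤ n → X n N ≡ Y n N) → ∀ n → X n ≈ Y n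
≈-unique-recurrence F X Y X-rec Y-rec low n = coeffwise λ N → agree N n (ℕP.m≤n+m N n)
  where
  agree : ∀ j n {N} → N ℕ.≤ n ℕ.+ j → X n N ≡ Y n N
  agree zero    n {N} N≤n+0   = low n (subst (N ℕ.≤_) (ℕP.+-identityʳ n) N≤n+0)
  agree (suc j) n {N} N≤n+1+j = begin
    X n N                   ≡⟨ coeff (X-rec n) N ⟩
    (F n ⊛ X (suc n)) N     ≡⟨ ⊛-coeff-local (F n) N (λ i≤N → agree j (suc n) (ℕP.≤-trans i≤N N≤1+n+j)) ⟩
    (F n ⊛ Y (suc n)) N     ≡⟨ coeff (Y-rec n) N ⟨
    Y n N                   ∎
    where
    open ≡-Reasoning
    N≤1+n+j : N ℕ.≤ suc n ℕ.+ j
    N≤1+n+j = subst (N ℕ.≤_) (ℕP.+-suc n j) N≤n+1+j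

euler : ∀ c n → pochInf c (suc n) ≈ sumInf (eulerTerm c n)
euler c = ≈-unique-recurrence (λ n → factor c (suc n)) (λ n → pochInf c (suc n)) (λ n → sumInf (eulerTerm c n))
  (pochInf-sucˡ c) (eulerSum-sucˡ c) (λ n N≤n → trans (pochInf-coeff-low c n N≤n) (sym (eulerSum-coeff-low c n N≤n)))

-- The finite identity

sgn-suc : ∀ n → sgn (suc n) ≡ - sgn n
sgn-suc n = ℤP.-1*i≡-i (sgn n)

mono-sgn-suc : ∀ n d → mono (sgn (suc n)) d ≈ negS (mono (sgn n) d)
mono-sgn-suc n d = S.trans (S.reflexive (cong (λ a → mono a d) (sgn-suc n))) (mono-neg (sgn n) d)

factor-+ : ∀ n k → factor (+ 1) (n ℕ.+ k) ≈ factor (+ 1) n ⊕ (mono (+ 1) n ⊛ factor (+ 1) k)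
factor-+ n k = begin
  factor (+ 1) (n ℕ.+ k)
    ≈⟨ factor≈1-mono (+ 1) (n ℕ.+ k) ⟩
  mono (+ 1) 0 ⊕ negS (mono (+ 1) (n ℕ.+ k))
    ≈⟨ ⊕-congˡ (mono (+ 1) 0) (S.-‿cong (mono-⊛-mono (+ 1) (+ 1) n k)) ⟨
  mono (+ 1) 0 ⊕ negS (mono (+ 1) n ⊛ mono (+ 1) k)
    ≈⟨ solve 2 (λ x y → con (+ 1) :- x :* y := (con (+ 1) :- x) :+ x :* (con (+ 1) :- y)) S.refl
         (mono (+ 1) n) (mono (+ 1) k) ⟩
  (mono (+ 1) 0 ⊕ negS (mono (+ 1) n)) ⊕ (mono (+ 1) n ⊛ (mono (+ 1) 0 ⊕ negS (mono (+ 1) k)))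
    ≈⟨ S.+-cong (factor≈1-mono (+ 1) n) (⊛-congˡ (mono (+ 1) n) (factor≈1-mono (+ 1) k)) ⟨
  factor (+ 1) n ⊕ (mono (+ 1) n ⊛ factor (+ 1) k) ∎
  where open ≈-Reasoning

factor-zero : factor (+ 1) 0 ≈ zeroS
factor-zero = coeffwise λ { zero → refl ; (suc _) → refl }

ratio : ℕ → ℕ → Series
ratio n k = (poch (- + 1) 1 n ⊛ invQPoch n) ⊛ invQPoch k

signedRatio qSignedRatio : ℕ → ℕ → Series
signedRatio  n k = mono (sgn n) 0 ⊛ ratio n k
qSignedRatio n k = mono (sgn n) k ⊛ ratio n k

factor-⊛-qSignedRatio-sucˡ : ∀ n k →
  factor (+ 1) (suc n) ⊛ qSignedRatio (suc n) k
  ≈ negS (qSignedRatio n k ⊕ (mono (+ 1) (suc n) ⊛ qSignedRatio n k))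
factor-⊛-qSignedRatio-sucˡ n k = begin
  F ⊛ (mono (sgn (suc n)) k ⊛ (((P ⊛ factor (- + 1) (suc n)) ⊛ I′) ⊛ Iₖ))
    ≈⟨ ⊛-congˡ F (S.*-cong (mono-sgn-suc n k) (⊛-congʳ Iₖ (⊛-congʳ I′ (⊛-congˡ P (factor≈1+mono (- + 1) (suc n)))))) ⟩
  F ⊛ (negS s ⊛ (((P ⊛ (mono (+ 1) 0 ⊕ q)) ⊛ I′) ⊛ Iₖ))
    ≈⟨ solve 6 (λ F s P q I′ Iₖ →
                  F :* (:- s :* (((P :* (con (+ 1) :+ q)) :* I′) :* Iₖ))
               := :- (s :* ((P :* (I′ :* F)) :* Iₖ) :+ q :* (s :* ((P :* (I′ :* F)) :* Iₖ))))
         S.refl F s P q I′ Iₖ ⟩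
  negS (w (I′ ⊛ F) ⊕ (q ⊛ w (I′ ⊛ F)))
    ≈⟨ S.-‿cong (S.+-cong (w-cong (invQPoch-⊛-factor n)) (⊛-congˡ q (w-cong (invQPoch-⊛-factor n)))) ⟩
  negS (qSignedRatio n k ⊕ (q ⊛ qSignedRatio n k)) ∎
  where
  open ≈-Reasoning
  F = factor (+ 1) (suc n)
  P = poch (- + 1) 1 n
  I′ = invQPoch (suc n)
  Iₖ = invQPoch k
  s = mono (sgn n) k
  q = mono (+ 1) (suc n)
  w : Series → Series
  w X = s ⊛ ((P ⊛ X) ⊛ Iₖ)
  w-cong : ∀ {X Y} → X ≈ Y → w X ≈ w Y
  w-cong X≈Y = ⊛-congˡ s (⊛-congʳ Iₖ (⊛-congˡ P X≈Y))

factor-⊛-qSignedRatio-sucʳ : ∀ n k →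
  (mono (+ 1) n ⊛ factor (+ 1) (suc k)) ⊛ qSignedRatio n (suc k) ≈ mono (+ 1) (suc n) ⊛ qSignedRatio n k
factor-⊛-qSignedRatio-sucʳ n k = begin
  (q ⊛ F) ⊛ (mono (sgn n) (suc k) ⊛ (PI ⊛ I′))
    ≈⟨ solve 5 (λ q F s PI I′ → (q :* F) :* (s :* (PI :* I′)) := (q :* s) :* (PI :* (I′ :* F))) S.refl
         q F (mono (sgn n) (suc k)) PI I′ ⟩
  (q ⊛ mono (sgn n) (suc k)) ⊛ (PI ⊛ (I′ ⊛ F))
    ≈⟨ S.*-cong (mono-1-⊛ n (sgn n) (suc k)) (⊛-congˡ PI (invQPoch-⊛-factor k)) ⟩
  mono (sgn n) (n ℕ.+ suc k) ⊛ ratio n k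
    ≡⟨ cong (λ d → mono (sgn n) d ⊛ ratio n k) (ℕP.+-suc n k) ⟩
  mono (sgn n) (suc n ℕ.+ k) ⊛ ratio n k
    ≈⟨ ⊛-congʳ (ratio n k) (mono-1-⊛ (suc n) (sgn n) k) ⟨
  (mono (+ 1) (suc n) ⊛ mono (sgn n) k) ⊛ ratio n k
    ≈⟨ S.*-assoc (mono (+ 1) (suc n)) (mono (sgn n) k) (ratio n k) ⟩
  mono (+ 1) (suc n) ⊛ qSignedRatio n k ∎
  where
  open ≈-Reasoning
  q = mono (+ 1) n
  F = factor (+ 1) (suc k)
  PI = poch (- + 1) 1 n ⊛ invQPoch n
  I′ = invQPoch (suc k)

-- Split 1 - q^{n+k} = (1 - q^n) + q^n (1 - q^k): the first part lowers n, the
-- second lowers k, and the q^{n+1}-shifted terms they produce cancel.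
factor-⊛-antidiag-qSignedRatio : ∀ m →
  factor (+ 1) (suc m) ⊛ antidiag (suc m) qSignedRatio ≈ negS (antidiag m qSignedRatio)
factor-⊛-antidiag-qSignedRatio m = begin
  factor (+ 1) (suc m) ⊛ antidiag (suc m) w
    ≈⟨ antidiag-⊛ (suc m) (factor (+ 1) (suc m)) w ⟩
  antidiag (suc m) (λ n k → factor (+ 1) (suc m) ⊛ w n k)
    ≈⟨ antidiag-cong (suc m) split ⟩
  antidiag (suc m) (λ n k → X n k ⊕ Y n k)
    ≈⟨ antidiag-⊕ (suc m) X Y ⟩
  antidiag (suc m) X ⊕ antidiag (suc m) Y
    ≈⟨ ⊕-congˡ (antidiag (suc m) X) (antidiag-sucʳ m Y) ⟩
  (X 0 (suc m) ⊕ antidiag m (λ n k → X (suc n) k)) ⊕ (antidiag m (λ n k → Y n (suc k)) ⊕ Y (suc m) 0)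
    ≈⟨ S.+-cong (S.+-cong (X-zero (suc m)) (antidiag-cong m (λ n k _ → factor-⊛-qSignedRatio-sucˡ n k)))
                (S.+-cong (antidiag-cong m (λ n k _ → factor-⊛-qSignedRatio-sucʳ n k)) (Y-zero (suc m))) ⟩
  (zeroS ⊕ antidiag m (λ n k → negS (w n k ⊕ Z n k))) ⊕ (antidiag m Z ⊕ zeroS)
    ≈⟨ S.+-cong (S.+-identityˡ (antidiag m (λ n k → negS (w n k ⊕ Z n k)))) (S.+-identityʳ (antidiag m Z)) ⟩
  antidiag m (λ n k → negS (w n k ⊕ Z n k)) ⊕ antidiag m Z
    ≈⟨ ⊕-congʳ (antidiag m Z) (S.trans (antidiag-neg m (λ n k → w n k ⊕ Z n k)) (S.-‿cong (antidiag-⊕ m w Z))) ⟩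
  negS (antidiag m w ⊕ antidiag m Z) ⊕ antidiag m Z
    ≈⟨ solve 2 (λ a b → :- (a :+ b) :+ b := :- a) S.refl (antidiag m w) (antidiag m Z) ⟩
  negS (antidiag m w) ∎
  where
  open ≈-Reasoning
  w = qSignedRatio
  X Y Z : ℕ → ℕ → Series
  X n k = factor (+ 1) n ⊛ w n k
  Y n k = (mono (+ 1) n ⊛ factor (+ 1) k) ⊛ w n k
  Z n k = mono (+ 1) (suc n) ⊛ w n k
  split : ∀ n k → n ℕ.+ k ≡ suc m → factor (+ 1) (suc m) ⊛ w n k ≈ X n k ⊕ Y n k
  split n k n+k≡1+m = begin
    factor (+ 1) (suc m) ⊛ w n k
      ≡⟨ cong (λ d → factor (+ 1) d ⊛ w n k) n+k≡1+m ⟨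
    factor (+ 1) (n ℕ.+ k) ⊛ w n k
      ≈⟨ ⊛-congʳ (w n k) (factor-+ n k) ⟩
    (factor (+ 1) n ⊕ (mono (+ 1) n ⊛ factor (+ 1) k)) ⊛ w n k
      ≈⟨ S.distribʳ (w n k) (factor (+ 1) n) (mono (+ 1) n ⊛ factor (+ 1) k) ⟩
    X n k ⊕ Y n k ∎
  X-zero : ∀ k → X 0 k ≈ zeroS
  X-zero k = S.trans (⊛-congʳ (w 0 k) factor-zero) (S.zeroˡ (w 0 k))
  Y-zero : ∀ n → Y n 0 ≈ zeroS
  Y-zero n = S.trans (⊛-congʳ (w n 0) (S.trans (⊛-congˡ (mono (+ 1) n) factor-zero) (S.zeroʳ (mono (+ 1) n))))
                     (S.zeroˡ (w n 0))

altInvQPoch : ℕ → Series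
altInvQPoch k = mono (sgn k) 0 ⊛ invQPoch k

ratio-zero : ratio 0 0 ≈ one
ratio-zero = S.trans (S.*-identityʳ (one ⊛ one)) (S.*-identityʳ one)

antidiag-qSignedRatio : ∀ m → antidiag m qSignedRatio ≈ altInvQPoch m
antidiag-qSignedRatio zero    = ⊛-congˡ (mono (+ 1) 0) ratio-zero
antidiag-qSignedRatio (suc m) = factor-cancelˡ m (begin
  F ⊛ antidiag (suc m) qSignedRatio   ≈⟨ factor-⊛-antidiag-qSignedRatio m ⟩
  negS (antidiag m qSignedRatio)      ≈⟨ S.-‿cong (antidiag-qSignedRatio m) ⟩
  negS (s ⊛ invQPoch m)               ≈⟨ S.-‿cong (⊛-congˡ s (invQPoch-⊛-factor m)) ⟨
  negS (s ⊛ (I′ ⊛ F))                 ≈⟨ solve 3 (λ s I′ F → :- (s :* (I′ :* F)) := F :* (:- s :* I′)) S.refl s I′ F ⟩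
  F ⊛ (negS s ⊛ I′)                   ≈⟨ ⊛-congˡ F (⊛-congʳ I′ (mono-sgn-suc m 0)) ⟨
  F ⊛ altInvQPoch (suc m)             ∎)
  where
  open ≈-Reasoning
  F = factor (+ 1) (suc m)
  s = mono (sgn m) 0
  I′ = invQPoch (suc m)

signedRatio-sucʳ : ∀ n k → signedRatio n (suc k) ≈ signedRatio n k ⊕ qSignedRatio n (suc k)
signedRatio-sucʳ n k = begin
  s ⊛ (PI ⊛ invQPoch (suc k))
    ≈⟨ ⊛-congˡ s (⊛-congˡ PI (invQPoch-suc k)) ⟩
  s ⊛ (PI ⊛ (invQPoch k ⊕ (q ⊛ invQPoch (suc k))))
    ≈⟨ solve 5 (λ s PI I I′ q → s :* (PI :* (I :+ q :* I′)) := s :* (PI :* I) :+ (s :* q) :* (PI :* I′)) S.refl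
         s PI (invQPoch k) (invQPoch (suc k)) q ⟩
  signedRatio n k ⊕ ((s ⊛ q) ⊛ ratio n (suc k))
    ≈⟨ ⊕-congˡ (signedRatio n k) (⊛-congʳ (ratio n (suc k))
         (S.trans (mono-⊛-mono (sgn n) (+ 1) 0 (suc k)) (S.reflexive (cong (λ a → mono a (suc k)) (ℤP.*-identityʳ (sgn n)))))) ⟩
  signedRatio n k ⊕ qSignedRatio n (suc k) ∎
  where
  open ≈-Reasoning
  s = mono (sgn n) 0
  PI = poch (- + 1) 1 n ⊛ invQPoch n
  q = mono (+ 1) (suc k)

antidiag-signedRatio : ∀ m → antidiag m signedRatio ≈ antidiag m (λ _ k → altInvQPoch k)
antidiag-signedRatio zero    = ⊛-congˡ (mono (+ 1) 0) ratio-zero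
antidiag-signedRatio (suc m) = begin
  antidiag (suc m) t
    ≈⟨ antidiag-sucʳ m t ⟩
  antidiag m (λ n k → t n (suc k)) ⊕ w (suc m) 0
    ≈⟨ ⊕-congʳ (w (suc m) 0) (S.trans (antidiag-cong m (λ n k _ → signedRatio-sucʳ n k))
                                      (antidiag-⊕ m t (λ n k → w n (suc k)))) ⟩
  (antidiag m t ⊕ antidiag m (λ n k → w n (suc k))) ⊕ w (suc m) 0
    ≈⟨ S.+-assoc (antidiag m t) (antidiag m (λ n k → w n (suc k))) (w (suc m) 0) ⟩
  antidiag m t ⊕ (antidiag m (λ n k → w n (suc k)) ⊕ w (suc m) 0)
    ≈⟨ ⊕-congˡ (antidiag m t) (antidiag-sucʳ m w) ⟨
  antidiag m t ⊕ antidiag (suc m) w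
    ≈⟨ S.+-cong (antidiag-signedRatio m) (antidiag-qSignedRatio (suc m)) ⟩
  antidiag m (λ _ k → altInvQPoch k) ⊕ altInvQPoch (suc m)
    ≈⟨ S.+-comm (antidiag m (λ _ k → altInvQPoch k)) (altInvQPoch (suc m)) ⟩
  antidiag (suc m) (λ _ k → altInvQPoch k) ∎
  where
  open ≈-Reasoning
  t = signedRatio
  w = qSignedRatio

-- Resummation of both sides

tri-+ : ∀ n k → tri (n ℕ.+ k) ≡ n ℕ.* k ℕ.+ tri k ℕ.+ tri n
tri-+ n zero rewrite ℕP.+-identityʳ n | ℕP.*-zeroʳ n = refl
tri-+ n (suc k) = begin
  tri (n ℕ.+ suc k)                              ≡⟨ cong tri (ℕP.+-suc n k) ⟩
  tri (n ℕ.+ k) ℕ.+ suc (n ℕ.+ k)                ≡⟨ cong (ℕ._+ suc (n ℕ.+ k)) (tri-+ n k) ⟩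
  n ℕ.* k ℕ.+ tri k ℕ.+ tri n ℕ.+ suc (n ℕ.+ k)  ≡⟨ rearrange n k (tri k) (tri n) ⟩
  n ℕ.* suc k ℕ.+ tri (suc k) ℕ.+ tri n          ∎
  where
  open ≡-Reasoning
  rearrange : ∀ n k t s → n ℕ.* k ℕ.+ t ℕ.+ s ℕ.+ suc (n ℕ.+ k) ≡ n ℕ.* suc k ℕ.+ (t ℕ.+ suc k) ℕ.+ s
  rearrange = ℕ-Solver.solve-∀

sgn-^ : ∀ c k → (- c) ^ k ≡ sgn k * c ^ k
sgn-^ c zero    = refl
sgn-^ c (suc k) = trans (cong (- c *_) (sgn-^ c k)) (rearrange c (sgn k) (c ^ k))
  where
  rearrange : ∀ c s p → - c * (s * p) ≡ - (+ 1) * s * (c * p)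
  rearrange = ℤ-Solver.solve-∀

sgn-collectˡ : ∀ c n k → (- c) ^ k * c ^ n ≡ c ^ (n ℕ.+ k) * sgn k
sgn-collectˡ c n k = begin
  (- c) ^ k * c ^ n       ≡⟨ cong (_* c ^ n) (sgn-^ c k) ⟩
  sgn k * c ^ k * c ^ n   ≡⟨ rearrange (sgn k) (c ^ k) (c ^ n) ⟩
  c ^ n * c ^ k * sgn k   ≡⟨ cong (_* sgn k) (ℤP.^-distribˡ-+-* c n k) ⟨
  c ^ (n ℕ.+ k) * sgn k   ∎
  where
  open ≡-Reasoning
  rearrange : ∀ s a b → s * a * b ≡ b * a * s
  rearrange = ℤ-Solver.solve-∀

sgn-collectʳ : ∀ c n k → (- - c) ^ k * (- c) ^ n ≡ c ^ (n ℕ.+ k) * sgn n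
sgn-collectʳ c n k = begin
  (- - c) ^ k * (- c) ^ n  ≡⟨ cong₂ (λ a b → a ^ k * b) (ℤP.neg-involutive c) (sgn-^ c n) ⟩
  c ^ k * (sgn n * c ^ n)  ≡⟨ rearrange (sgn n) (c ^ k) (c ^ n) ⟩
  c ^ n * c ^ k * sgn n    ≡⟨ cong (_* sgn n) (ℤP.^-distribˡ-+-* c n k) ⟨
  c ^ (n ℕ.+ k) * sgn n    ∎
  where
  open ≡-Reasoning
  rearrange : ∀ s a b → a * (s * b) ≡ b * a * s
  rearrange = ℤ-Solver.solve-∀

mono-merge-tri : ∀ a b n k → mono a (n ℕ.* k ℕ.+ tri k) ⊛ mono b (tri n) ≈ mono (a * b) (tri (n ℕ.+ k))
mono-merge-tri a b n k = S.trans (mono-⊛-mono a b (n ℕ.* k ℕ.+ tri k) (tri n))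
                                 (S.reflexive (cong (mono (a * b)) (sym (tri-+ n k))))

mono-split-scalar : ∀ a s d → mono (a * s) d ≈ mono a d ⊛ mono s 0
mono-split-scalar a s d = S.sym (S.trans (mono-⊛-mono a s d 0) (S.reflexive (cong (mono (a * s)) (ℕP.+-identityʳ d))))

sumInf-euler-expand : ∀ c′ c (g : ℕ → Series) (G : ℕ → ℕ → Series) →
  (∀ n k → eulerTerm c′ n k ⊛ g n ≈ mono (c ^ (n ℕ.+ k)) (tri (n ℕ.+ k)) ⊛ G n k) →
  sumInf (λ n → pochInf c′ (suc n) ⊛ g n) ≈ sumInf (λ m → mono (c ^ m) (tri m) ⊛ antidiag m G)
sumInf-euler-expand c′ c g G term = begin
  sumInf (λ n → pochInf c′ (suc n) ⊛ g n)
    ≈⟨ sumInf-cong (λ n → ⊛-congʳ (g n) (euler c′ n)) ⟩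
  sumInf (λ n → sumInf (eulerTerm c′ n) ⊛ g n)
    ≈⟨ sumInf-cong (λ n → sumInf-⊛ʳ (g n) (eulerTerm-summable c′ n)) ⟩
  sumInf (λ n → sumInf (λ k → eulerTerm c′ n k ⊛ g n))
    ≈⟨ sumInf-cong (λ n → sumInf-cong (term n)) ⟩
  sumInf (λ n → sumInf (u n))
    ≈⟨ sumInf-antidiag u-summable ⟩
  sumInf (λ m → antidiag m u)
    ≈⟨ sumInf-cong (λ m → S.trans (antidiag-cong m (λ n k n+k≡m → S.reflexive (cong (λ j → mono (c ^ j) (tri j) ⊛ G n k) n+k≡m)))
                                  (S.sym (antidiag-⊛ m (mono (c ^ m) (tri m)) G))) ⟩
  sumInf (λ m → mono (c ^ m) (tri m) ⊛ antidiag m G) ∎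
  where
  open ≈-Reasoning
  u : ℕ → ℕ → Series
  u n k = mono (c ^ (n ℕ.+ k)) (tri (n ℕ.+ k)) ⊛ G n k
  u-summable : Summable₂ u
  u-summable n k = q^∣-weaken (u n k) (tri-≥ (n ℕ.+ k)) (mono-⊛-coeff-< (c ^ (n ℕ.+ k)) (tri (n ℕ.+ k)) (G n k))

eulerTerm-⊛-lhs : ∀ c n k →
  eulerTerm c n k ⊛ mono (c ^ n) (tri n) ≈ mono (c ^ (n ℕ.+ k)) (tri (n ℕ.+ k)) ⊛ altInvQPoch k
eulerTerm-⊛-lhs c n k = begin
  (x ⊛ invQPoch k) ⊛ y
    ≈⟨ solve 3 (λ x I y → (x :* I) :* y := (x :* y) :* I) S.refl x (invQPoch k) y ⟩
  (x ⊛ y) ⊛ invQPoch k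
    ≈⟨ ⊛-congʳ (invQPoch k) (mono-merge-tri ((- c) ^ k) (c ^ n) n k) ⟩
  mono ((- c) ^ k * c ^ n) (tri (n ℕ.+ k)) ⊛ invQPoch k
    ≡⟨ cong (λ a → mono a (tri (n ℕ.+ k)) ⊛ invQPoch k) (sgn-collectˡ c n k) ⟩
  mono (c ^ (n ℕ.+ k) * sgn k) (tri (n ℕ.+ k)) ⊛ invQPoch k
    ≈⟨ ⊛-congʳ (invQPoch k) (mono-split-scalar (c ^ (n ℕ.+ k)) (sgn k) (tri (n ℕ.+ k))) ⟩
  (mono (c ^ (n ℕ.+ k)) (tri (n ℕ.+ k)) ⊛ mono (sgn k) 0) ⊛ invQPoch k
    ≈⟨ S.*-assoc (mono (c ^ (n ℕ.+ k)) (tri (n ℕ.+ k))) (mono (sgn k) 0) (invQPoch k) ⟩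
  mono (c ^ (n ℕ.+ k)) (tri (n ℕ.+ k)) ⊛ altInvQPoch k ∎
  where
  open ≈-Reasoning
  x = mono ((- c) ^ k) (n ℕ.* k ℕ.+ tri k)
  y = mono (c ^ n) (tri n)

eulerTerm-⊛-rhs : ∀ c n k →
  eulerTerm (- c) n k ⊛ (poch (- + 1) 1 n ⊛ (invQPoch n ⊛ mono ((- c) ^ n) (tri n)))
  ≈ mono (c ^ (n ℕ.+ k)) (tri (n ℕ.+ k)) ⊛ signedRatio n k
eulerTerm-⊛-rhs c n k = begin
  (x ⊛ invQPoch k) ⊛ (poch (- + 1) 1 n ⊛ (invQPoch n ⊛ y))
    ≈⟨ solve 5 (λ x I P J y → (x :* I) :* (P :* (J :* y)) := (x :* y) :* ((P :* J) :* I)) S.refl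
         x (invQPoch k) (poch (- + 1) 1 n) (invQPoch n) y ⟩
  (x ⊛ y) ⊛ ratio n k
    ≈⟨ ⊛-congʳ (ratio n k) (mono-merge-tri ((- - c) ^ k) ((- c) ^ n) n k) ⟩
  mono ((- - c) ^ k * (- c) ^ n) (tri (n ℕ.+ k)) ⊛ ratio n k
    ≡⟨ cong (λ a → mono a (tri (n ℕ.+ k)) ⊛ ratio n k) (sgn-collectʳ c n k) ⟩
  mono (c ^ (n ℕ.+ k) * sgn n) (tri (n ℕ.+ k)) ⊛ ratio n k
    ≈⟨ ⊛-congʳ (ratio n k) (mono-split-scalar (c ^ (n ℕ.+ k)) (sgn n) (tri (n ℕ.+ k))) ⟩
  (mono (c ^ (n ℕ.+ k)) (tri (n ℕ.+ k)) ⊛ mono (sgn n) 0) ⊛ ratio n k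
    ≈⟨ S.*-assoc (mono (c ^ (n ℕ.+ k)) (tri (n ℕ.+ k))) (mono (sgn n) 0) (ratio n k) ⟩
  mono (c ^ (n ℕ.+ k)) (tri (n ℕ.+ k)) ⊛ signedRatio n k ∎
  where
  open ≈-Reasoning
  x = mono ((- - c) ^ k) (n ℕ.* k ℕ.+ tri k)
  y = mono ((- c) ^ n) (tri n)

pochInf-tri-sum-duality : ∀ c →
  sumInf (λ n → pochInf c (suc n) ⊛ mono (c ^ n) (tri n))
  ≈ sumInf (λ n → pochInf (- c) (suc n) ⊛ (poch (- + 1) 1 n ⊛ (invQPoch n ⊛ mono ((- c) ^ n) (tri n))))
pochInf-tri-sum-duality c = begin
  sumInf (λ n → pochInf c (suc n) ⊛ mono (c ^ n) (tri n))
    ≈⟨ sumInf-euler-expand c c (λ n → mono (c ^ n) (tri n)) (λ _ k → altInvQPoch k) (eulerTerm-⊛-lhs c) ⟩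
  sumInf (λ m → mono (c ^ m) (tri m) ⊛ antidiag m (λ _ k → altInvQPoch k))
    ≈⟨ sumInf-cong (λ m → ⊛-congˡ (mono (c ^ m) (tri m)) (antidiag-signedRatio m)) ⟨
  sumInf (λ m → mono (c ^ m) (tri m) ⊛ antidiag m signedRatio)
    ≈⟨ sumInf-euler-expand (- c) c dualWeight signedRatio (eulerTerm-⊛-rhs c) ⟨
  sumInf (λ n → pochInf (- c) (suc n) ⊛ dualWeight n) ∎
  where
  open ≈-Reasoning
  dualWeight : ℕ → Series
  dualWeight n = poch (- + 1) 1 n ⊛ (invQPoch n ⊛ mono ((- c) ^ n) (tri n))

corollary2p1 : ((N : ℕ) → sumInf lhs1 N ≡ sumInf rhs1 N)
               × ((N : ℕ) → sumInf lhs2 N ≡ sumInf rhs2 N)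
corollary2p1 = coeff identity₁ , coeff identity₂
  where
  mono-1^ : ∀ n → mono (+ 1) (tri n) ≈ mono ((+ 1) ^ n) (tri n)
  mono-1^ n = S.reflexive (cong (λ a → mono a (tri n)) (sym (ℤP.^-zeroˡ n)))
  identity₁ : sumInf lhs1 ≈ sumInf rhs1
  identity₁ = S.trans (sumInf-cong (λ n → ⊛-congˡ (pochInf (+ 1) (suc n)) (mono-1^ n)))
                      (pochInf-tri-sum-duality (+ 1))
  identity₂ : sumInf lhs2 ≈ sumInf rhs2
  identity₂ = S.trans (pochInf-tri-sum-duality (- + 1))
                      (sumInf-cong (λ n → ⊛-congˡ (pochInf (+ 1) (suc n))
                        (⊛-congˡ (poch (- + 1) 1 n) (⊛-congˡ (invQPoch n) (S.sym (mono-1^ n))))))
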